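{- Let $0<\varepsilon\le 1/2$, let $r,\mu$ be positive integers, let $h:\{0,1\}^n\to\{0,1\}$ with $h^{ -1}(1)\ne\emptyset$, let $\emptyset\ne R\subseteq[n]$ with $\overline R=[n]\setminus R$, and let $\mathfrak J:\{0,1\}^R\to\{0,1\}$ with $\mathfrak J^{ -1}(1)\neq\emptyset$. Define $\Gamma:\{0,1\}^{\overline R}\to\{0,1\}$ by $\Gamma(\alpha)=1$ iff $\Pr_{z\sim\mathfrak J^{ -1}(1)}[h(\alpha\circ z)=1]\ge0.9$, and $\gamma:\{0,1\}^n\to\{0,1\}$ by $\gamma(z)=1$ iff $\Gamma(z_{\overline R})=1$ and $\mathfrak J(z_R)=1$. Assume $\mathrm{reldist}(h,g)>\varepsilon$ for every $(r,\mu)$-factored-DNF $g$ over $\{0,1\}^n$, and moreover: (a) $\mathrm{reldist}(\mathfrak J,\mathfrak D)\le\varepsilon/10$ for some $r$-term, $\mu$-junta DNF $\mathfrak D:\{0,1\}^R\to\{0,1\}$; (b) $|h^{ -1}(1)\setminus\gamma^{ -1}(1)|\le\varepsilon|h^{ -1}(1)|/20$; (c) $|\gamma^{ -1}(1)\setminus h^{ -1}(1)|\le\varepsilon|h^{ -1}(1)|/20$. Then $\mathrm{reldist}(\Gamma,C)>\varepsilon/10$ for every conjunction $C$ over $\{0,1\}^{\overline R}$.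
   Context: All samples are uniform over the indicated sets. For $z\in\{0,1\}^n$ and $A\subseteq[n]$, $z_A$ is the restriction of $z$ to $A$; $\alpha\circ z$ denotes the string in $\{0,1\}^n$ agreeing with $\alpha$ on $\overline R$ and with $z$ on $R$. $\mathrm{reldist}(f,g)=|f^{ -1}(1)\triangle g^{ -1}(1)|/|f^{ -1}(1)|$. An $r$-term, $\mu$-junta DNF is a DNF with at most $r$ terms (conjunctions of literals) that depends on at most $\mu$ variables. A function $g:\{0,1\}^n\to\{0,1\}$ is an $(r,\mu)$-factored-DNF if $g=H\wedge(T_1\vee\cdots\vee T_{r'})$ for some $r'\le r$, where $H$ is a conjunction of literals of arbitrary width, $T_1,\dots,T_{r'}$ are conjunctions of literals, the variables of $H$ are disjoint from those appearing in $T_1,\dots,T_{r'}$, and at most $\mu$ variables appear in $T_1,\dots,T_{r'}$ in total. -}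

module Defs where

open import Data.Bool using (Bool; true; false; if_then_else_; _∧_; _∨_; not; _xor_)
open import Data.Nat using (ℕ; zero; suc; _≤_; _<_; _*_)
open import Data.Nat as ℕ using ()
open import Data.Fin using (Fin)
open import Data.Fin.Subset using (Subset; _∈_; _∉_; ∣_∣; ∁; ⊤; inside; outside)
open import Data.Vec using (Vec; []; _∷_; lookup; zipWith; map)
open import Data.List as L using (List; []; _∷_; length; _++_; concatMap)
open import Data.List.Relation.Unary.All using (All)
import Data.List.Membership.Propositional as M
open import Data.Product using (Σ; _×_; _,_; proj₁; proj₂; ∃)
open import Data.Integer using (+_)
open import Data.Rational using (ℚ; _/_)
open import Data.Rational as ℚ using ()
open import Relation.Binary.PropositionalEquality using (_≡_)
open import Relation.Nullary.Decidable using (⌊_⌋)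

Point : ℕ → Set
Point n = Vec Bool n

-- A function on {0,1}^A (A ⊆ [n]) is represented by
-- a function Point n → Bool that is only ever evaluated on points of
-- cube A (points that are 0 outside A), which is in canonical bijection
-- with {0,1}^A.
BF : ℕ → Set
BF n = Point n → Bool

-- cube A : all points z ∈ {0,1}^n with z_i = 0 for i ∉ A (each exactly once);
-- this is the canonical copy of {0,1}^A inside {0,1}^n.
cube : ∀ {n} → Subset n → List (Point n)
cube [] = [] ∷ []
cube (true ∷ A) = L.map (false ∷_) (cube A) ++ L.map (true ∷_) (cube A)
cube (false ∷ A) = L.map (false ∷_) (cube A)

restrict : ∀ {n} → Subset n → Point n → Point n
restrict A z = zipWith _∧_ A z

compose : ∀ {n} → Subset n → Point n → Point n → Point n
compose [] [] [] = []
compose (s ∷ R) (a ∷ α) (z ∷ zs) = (if s then z else a) ∷ compose R α zs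

count : ∀ {n} → BF n → List (Point n) → ℕ
count f [] = 0
count f (x ∷ xs) = if f x then suc (count f xs) else count f xs

ones : ∀ {n} → Subset n → BF n → ℕ
ones A f = count f (cube A)

symdiff : ∀ {n} → Subset n → BF n → BF n → ℕ
symdiff A f g = count (λ x → f x xor g x) (cube A)

setminus : ∀ {n} → Subset n → BF n → BF n → ℕ
setminus A f g = count (λ x → f x ∧ not (g x)) (cube A)

ℕtoℚ : ℕ → ℚ
ℕtoℚ k = + k / 1

-- reldist(f,g) > ε  and  reldist(f,g) ≤ ε  (over {0,1}^A), written with the
-- denominator |f^{-1}(1)| multiplied out.
reldistGt : ∀ {n} → Subset n → BF n → BF n → ℚ → Set
reldistGt A f g ε = ε ℚ.* ℕtoℚ (ones A f) ℚ.< ℕtoℚ (symdiff A f g)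

reldistLe : ∀ {n} → Subset n → BF n → BF n → ℚ → Set
reldistLe A f g ε = ℕtoℚ (symdiff A f g) ℚ.≤ ε ℚ.* ℕtoℚ (ones A f)

Literal : ℕ → Set
Literal n = Fin n × Bool

Term : ℕ → Set
Term n = List (Literal n)

DNF : ℕ → Set
DNF n = List (Term n)

evalLit : ∀ {n} → Literal n → Point n → Bool
evalLit (i , true) x = lookup x i
evalLit (i , false) x = not (lookup x i)

evalTerm : ∀ {n} → Term n → BF n
evalTerm [] x = true
evalTerm (l ∷ t) x = evalLit l x ∧ evalTerm t x

evalDNF : ∀ {n} → DNF n → BF n
evalDNF [] x = false
evalDNF (t ∷ d) x = evalTerm t x ∨ evalDNF d x

TermOver : ∀ {n} → Subset n → Term n → Set
TermOver A t = All (λ l → proj₁ l ∈ A) t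

DNFOver : ∀ {n} → Subset n → DNF n → Set
DNFOver A d = All (TermOver A) d

IsJunta : ∀ {n} → Subset n → BF n → ℕ → Set
IsJunta {n} A f μ = Σ (Subset n) λ S → ∣ S ∣ ≤ μ ×
  (∀ x y → x M.∈ cube A → y M.∈ cube A → restrict S x ≡ restrict S y → f x ≡ f y)

IsJuntaDNF : ∀ {n} → Subset n → ℕ → ℕ → DNF n → Set
IsJuntaDNF A r μ D = DNFOver A D × length D ≤ r × IsJunta A (evalDNF D) μ

IsConjunction : ∀ {n} → Subset n → Term n → Set
IsConjunction A C = TermOver A C

record FactoredDNF (n r μ : ℕ) : Set where
  field
    H  : Term n
    Ts : DNF n
    few-terms : length Ts ≤ r
    S  : Subset n
    S-small : ∣ S ∣ ≤ μ
    Ts-in-S : DNFOver S Ts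
    H-disjoint : All (λ l → proj₁ l ∉ S) H

evalFactored : ∀ {n r μ} → FactoredDNF n r μ → BF n
evalFactored g x = evalTerm (FactoredDNF.H g) x ∧ evalDNF (FactoredDNF.Ts g) x

-- Γ(α) = 1 iff Pr_{z ∼ 𝔍^{-1}(1)} [h(α ∘ z) = 1] ≥ 0.9, i.e.
-- 9 · |𝔍^{-1}(1)| ≤ 10 · |{z ∈ 𝔍^{-1}(1) : h(α∘z) = 1}|.
Gamma : ∀ {n} → Subset n → BF n → BF n → BF n
Gamma R h J α =
  ⌊ 9 * ones R J ℕ.≤? 10 * count (λ z → J z ∧ h (compose R α z)) (cube R) ⌋

gammaSmall : ∀ {n} → Subset n → BF n → BF n → BF n
gammaSmall R h J z = Gamma R h J (restrict (∁ R) z) ∧ J (restrict R z)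

-- Suppose Γ were ε/10-close to a conjunction C over R̄. Fixing to 0 the variables of D outside
-- its junta set makes g(z) = C(z_R̄) ∧ D(z_R) an (r,μ)-factored DNF. Because γ(z) = Γ(z_R̄) ∧ 𝔍(z_R)
-- is a product,
--   |γ △ g| ≤ |Γ △ C|·|𝔍| + |C|·|𝔍 △ D| ≤ 3(ε/10)|Γ|·|𝔍| = 3(ε/10)|γ|,
-- and |γ| ≤ |h| + |γ ∖ h| ≤ 2|h|. With (b) and (c) this gives
--   |h △ g| ≤ |h ∖ γ| + |γ ∖ h| + |γ △ g| ≤ (7/10)ε|h|,
-- contradicting the assumption that h is ε-far from every (r,μ)-factored DNF.
module Submission where

open import Defs
open import Data.Bool as Bool using (true; false; not; _∧_; _∨_; _xor_; if_then_else_; b≤b)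
open import Data.Bool.Properties using (≤-maximum; ∧-distribˡ-xor; ∧-distribʳ-xor)
open import Data.Fin.Subset using (Subset; Nonempty; ∁; ⊤; inside; outside)
open import Data.Vec using ([]; _∷_)
open import Data.List as List using ([]; _∷_; _++_)
open import Function using (_∘_)
open import Relation.Binary.PropositionalEquality

xor-triangle : ∀ a b c → a xor c Bool.≤ (a xor b) ∨ (b xor c)
xor-triangle false false _ = b≤b
xor-triangle false true  c = ≤-maximum c
xor-triangle true  false c = ≤-maximum (not c)
xor-triangle true  true  _ = b≤b

xor-≤-differences : ∀ a b → a xor b Bool.≤ (a ∧ not b) ∨ (b ∧ not a)
xor-≤-differences false false = b≤b
xor-≤-differences false true  = b≤b
xor-≤-differences true  false = b≤b
xor-≤-differences true  true  = b≤b

≤-∨-difference : ∀ a b → a Bool.≤ b ∨ (a ∧ not b)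
≤-∨-difference a     true  = ≤-maximum a
≤-∨-difference false false = b≤b
≤-∨-difference true  false = b≤b

≤-∨-xor : ∀ a b → b Bool.≤ a ∨ (a xor b)
≤-∨-xor false _ = b≤b
≤-∨-xor true  b = ≤-maximum b

-- gammaSmall R h J is definitionally Gamma R h J ⊗⟨ R ⟩ J.
_⊗⟨_⟩_ : ∀ {n} → BF n → Subset n → BF n → BF n
(F ⊗⟨ R ⟩ G) z = F (restrict (∁ R) z) ∧ G (restrict R z)

module Counting where

  open import Data.Nat using (ℕ; suc; _+_; _*_; _≤_; z≤n; s≤s)
  open import Data.Nat.Properties
    using ( ≤-trans; ≤-reflexive; +-suc; n≤1+n; m≤n⇒m≤1+n; +-mono-≤; +-monoʳ-≤; *-monoˡ-≤
          ; *-distribˡ-+; *-distribʳ-+; module ≤-Reasoning)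

  private variable n : ℕ

  count-cong : ∀ {f g : BF n} → f ≗ g → ∀ xs → count f xs ≡ count g xs
  count-cong f≗g []       = refl
  count-cong f≗g (x ∷ xs) = cong₂ (λ b c → if b then suc c else c) (f≗g x) (count-cong f≗g xs)

  count-++ : ∀ (f : BF n) xs ys → count f (xs ++ ys) ≡ count f xs + count f ys
  count-++ f []       ys = refl
  count-++ f (x ∷ xs) ys with f x
  ... | true  = cong suc (count-++ f xs ys)
  ... | false = count-++ f xs ys

  count-map : ∀ {m} (f : BF n) (φ : Point m → Point n) xs → count f (List.map φ xs) ≡ count (f ∘ φ) xs
  count-map f φ []       = refl
  count-map f φ (x ∷ xs) with f (φ x)
  ... | true  = cong suc (count-map f φ xs)
  ... | false = count-map f φ xs

  count-mono : ∀ {f g : BF n} → (∀ x → f x Bool.≤ g x) → ∀ xs → count f xs ≤ count g xs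
  count-mono f≤g []       = z≤n
  count-mono {f = f} {g} f≤g (x ∷ xs) with f x | g x | f≤g x
  ... | false | false | _  = count-mono f≤g xs
  ... | false | true  | _  = m≤n⇒m≤1+n (count-mono f≤g xs)
  ... | true  | true  | _  = s≤s (count-mono f≤g xs)
  ... | true  | false | ()

  count-∨ : ∀ (f g : BF n) xs → count (λ x → f x ∨ g x) xs ≤ count f xs + count g xs
  count-∨ f g []       = z≤n
  count-∨ f g (x ∷ xs) with f x | g x
  ... | false | false = count-∨ f g xs
  ... | false | true  = ≤-trans (s≤s (count-∨ f g xs)) (≤-reflexive (sym (+-suc _ _)))
  ... | true  | false = s≤s (count-∨ f g xs)
  ... | true  | true  = s≤s (≤-trans (count-∨ f g xs) (+-monoʳ-≤ _ (n≤1+n _)))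

  count-≤-+ : ∀ {f g k : BF n} → (∀ x → f x Bool.≤ g x ∨ k x) →
    ∀ xs → count f xs ≤ count g xs + count k xs
  count-≤-+ {g = g} {k} f≤g∨k xs = ≤-trans (count-mono f≤g∨k xs) (count-∨ g k xs)

  symdiff-triangle : ∀ (A : Subset n) f g k → symdiff A f k ≤ symdiff A f g + symdiff A g k
  symdiff-triangle A f g k = count-≤-+ (λ x → xor-triangle (f x) (g x) (k x)) (cube A)

  symdiff≤setminus+setminus : ∀ (A : Subset n) f g → symdiff A f g ≤ setminus A f g + setminus A g f
  symdiff≤setminus+setminus A f g = count-≤-+ (λ x → xor-≤-differences (f x) (g x)) (cube A)

  ones≤ones+setminus : ∀ (A : Subset n) f g → ones A f ≤ ones A g + setminus A f g
  ones≤ones+setminus A f g = count-≤-+ (λ x → ≤-∨-difference (f x) (g x)) (cube A)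

  ones≤ones+symdiff : ∀ (A : Subset n) f g → ones A g ≤ ones A f + symdiff A f g
  ones≤ones+symdiff A f g = count-≤-+ (λ x → ≤-∨-xor (f x) (g x)) (cube A)

  count-cube-inside : ∀ (f : BF (suc n)) A →
    count f (cube (inside ∷ A)) ≡ count (f ∘ (false ∷_)) (cube A) + count (f ∘ (true ∷_)) (cube A)
  count-cube-inside f A =
    trans (count-++ f (List.map (false ∷_) (cube A)) (List.map (true ∷_) (cube A)))
          (cong₂ _+_ (count-map f (false ∷_) (cube A)) (count-map f (true ∷_) (cube A)))

  count-cube-outside : ∀ (f : BF (suc n)) A →
    count f (cube (outside ∷ A)) ≡ count (f ∘ (false ∷_)) (cube A)
  count-cube-outside f A = count-map f (false ∷_) (cube A)

  ones-⊗ : ∀ (R : Subset n) F G → ones ⊤ (F ⊗⟨ R ⟩ G) ≡ ones (∁ R) F * ones R G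
  ones-⊗ [] F G with F [] | G []
  ... | false | _     = refl
  ... | true  | false = refl
  ... | true  | true  = refl
  ones-⊗ {suc n} (inside ∷ R) F G = begin
    ones (inside ∷ ⊤) (F ⊗⟨ inside ∷ R ⟩ G)
      ≡⟨ count-cube-inside (F ⊗⟨ inside ∷ R ⟩ G) ⊤ ⟩
    ones ⊤ (F₀ ⊗⟨ R ⟩ G₀) + ones ⊤ (F₀ ⊗⟨ R ⟩ G₁)
      ≡⟨ cong₂ _+_ (ones-⊗ R F₀ G₀) (ones-⊗ R F₀ G₁) ⟩
    ones (∁ R) F₀ * ones R G₀ + ones (∁ R) F₀ * ones R G₁
      ≡⟨ *-distribˡ-+ (ones (∁ R) F₀) (ones R G₀) (ones R G₁) ⟨
    ones (∁ R) F₀ * (ones R G₀ + ones R G₁)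
      ≡⟨ cong₂ _*_ (count-cube-outside F (∁ R)) (count-cube-inside G R) ⟨
    ones (outside ∷ ∁ R) F * ones (inside ∷ R) G ∎
    where
    open ≡-Reasoning
    F₀ G₀ G₁ : BF n
    F₀ = F ∘ (false ∷_)
    G₀ = G ∘ (false ∷_)
    G₁ = G ∘ (true ∷_)
  ones-⊗ {suc n} (outside ∷ R) F G = begin
    ones (inside ∷ ⊤) (F ⊗⟨ outside ∷ R ⟩ G)
      ≡⟨ count-cube-inside (F ⊗⟨ outside ∷ R ⟩ G) ⊤ ⟩
    ones ⊤ (F₀ ⊗⟨ R ⟩ G₀) + ones ⊤ (F₁ ⊗⟨ R ⟩ G₀)
      ≡⟨ cong₂ _+_ (ones-⊗ R F₀ G₀) (ones-⊗ R F₁ G₀) ⟩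
    ones (∁ R) F₀ * ones R G₀ + ones (∁ R) F₁ * ones R G₀
      ≡⟨ *-distribʳ-+ (ones R G₀) (ones (∁ R) F₀) (ones (∁ R) F₁) ⟨
    (ones (∁ R) F₀ + ones (∁ R) F₁) * ones R G₀
      ≡⟨ cong₂ _*_ (count-cube-inside F (∁ R)) (count-cube-outside G R) ⟨
    ones (inside ∷ ∁ R) F * ones (outside ∷ R) G ∎
    where
    open ≡-Reasoning
    F₀ F₁ G₀ : BF n
    F₀ = F ∘ (false ∷_)
    F₁ = F ∘ (true ∷_)
    G₀ = G ∘ (false ∷_)

  symdiff-⊗ˡ : ∀ (R : Subset n) F F' G →
    symdiff ⊤ (F ⊗⟨ R ⟩ G) (F' ⊗⟨ R ⟩ G) ≡ symdiff (∁ R) F F' * ones R G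
  symdiff-⊗ˡ R F F' G = trans (count-cong xor-⊗ (cube ⊤)) (ones-⊗ R (λ u → F u xor F' u) G)
    where
    xor-⊗ : (λ z → (F ⊗⟨ R ⟩ G) z xor (F' ⊗⟨ R ⟩ G) z) ≗ (λ u → F u xor F' u) ⊗⟨ R ⟩ G
    xor-⊗ z = sym (∧-distribʳ-xor (G (restrict R z)) (F (restrict (∁ R) z)) (F' (restrict (∁ R) z)))

  symdiff-⊗ʳ : ∀ (R : Subset n) F G G' →
    symdiff ⊤ (F ⊗⟨ R ⟩ G) (F ⊗⟨ R ⟩ G') ≡ ones (∁ R) F * symdiff R G G'
  symdiff-⊗ʳ R F G G' = trans (count-cong xor-⊗ (cube ⊤)) (ones-⊗ R F (λ u → G u xor G' u))
    where
    xor-⊗ : (λ z → (F ⊗⟨ R ⟩ G) z xor (F ⊗⟨ R ⟩ G') z) ≗ F ⊗⟨ R ⟩ (λ u → G u xor G' u)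
    xor-⊗ z = sym (∧-distribˡ-xor (F (restrict (∁ R) z)) (G (restrict R z)) (G' (restrict R z)))

  symdiff-⊗-≤ : ∀ (R : Subset n) F F' G G' →
    symdiff ⊤ (F ⊗⟨ R ⟩ G) (F' ⊗⟨ R ⟩ G')
      ≤ symdiff (∁ R) F F' * ones R G + (ones (∁ R) F + symdiff (∁ R) F F') * symdiff R G G'
  symdiff-⊗-≤ R F F' G G' = begin
    symdiff ⊤ (F ⊗⟨ R ⟩ G) (F' ⊗⟨ R ⟩ G')
      ≤⟨ symdiff-triangle ⊤ (F ⊗⟨ R ⟩ G) (F' ⊗⟨ R ⟩ G) (F' ⊗⟨ R ⟩ G') ⟩
    symdiff ⊤ (F ⊗⟨ R ⟩ G) (F' ⊗⟨ R ⟩ G) + symdiff ⊤ (F' ⊗⟨ R ⟩ G) (F' ⊗⟨ R ⟩ G')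
      ≡⟨ cong₂ _+_ (symdiff-⊗ˡ R F F' G) (symdiff-⊗ʳ R F' G G') ⟩
    symdiff (∁ R) F F' * ones R G + ones (∁ R) F' * symdiff R G G'
      ≤⟨ +-monoʳ-≤ _ (*-monoˡ-≤ (symdiff R G G') (ones≤ones+symdiff (∁ R) F F')) ⟩
    symdiff (∁ R) F F' * ones R G + (ones (∁ R) F + symdiff (∁ R) F F') * symdiff R G G' ∎
    where open ≤-Reasoning

  symdiff-≤-via-⊗ : ∀ (R : Subset n) (h g F F' G G' : BF n) → g ≗ F' ⊗⟨ R ⟩ G' →
    symdiff ⊤ h g
      ≤ (setminus ⊤ h (F ⊗⟨ R ⟩ G) + setminus ⊤ (F ⊗⟨ R ⟩ G) h)
        + (symdiff (∁ R) F F' * ones R G + (ones (∁ R) F + symdiff (∁ R) F F') * symdiff R G G')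
  symdiff-≤-via-⊗ R h g F F' G G' g≗F'⊗G' = begin
    symdiff ⊤ h g
      ≤⟨ symdiff-triangle ⊤ h (F ⊗⟨ R ⟩ G) g ⟩
    symdiff ⊤ h (F ⊗⟨ R ⟩ G) + symdiff ⊤ (F ⊗⟨ R ⟩ G) g
      ≡⟨ cong (symdiff ⊤ h (F ⊗⟨ R ⟩ G) +_)
              (count-cong (λ z → cong ((F ⊗⟨ R ⟩ G) z xor_) (g≗F'⊗G' z)) (cube ⊤)) ⟩
    symdiff ⊤ h (F ⊗⟨ R ⟩ G) + symdiff ⊤ (F ⊗⟨ R ⟩ G) (F' ⊗⟨ R ⟩ G')
      ≤⟨ +-mono-≤ (symdiff≤setminus+setminus ⊤ h (F ⊗⟨ R ⟩ G)) (symdiff-⊗-≤ R F F' G G') ⟩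
    (setminus ⊤ h (F ⊗⟨ R ⟩ G) + setminus ⊤ (F ⊗⟨ R ⟩ G) h)
      + (symdiff (∁ R) F F' * ones R G + (ones (∁ R) F + symdiff (∁ R) F F') * symdiff R G G') ∎
    where open ≤-Reasoning

module Restriction where

  open import Data.Nat using (ℕ)
  open import Data.Nat.Properties using (≤-trans)
  open import Data.Fin using (Fin)
  open import Data.Fin.Subset using (_∈_; _∉_; _∩_)
  open import Data.Fin.Subset.Properties
    using (_∈?_; ∩-assoc; ∩-comm; ∩-idem; ∣p∩q∣≤∣q∣; x∈p∩q⁻; x∈∁p⇒x∉p)
  open import Data.Vec using (lookup)
  open import Data.Vec.Properties using (lookup-zipWith; []=⇒lookup; lookup⇒[]=)
  open import Data.Bool.Properties using (∧-zeroʳ)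
  open import Data.List.Properties using (length-mapMaybe)
  open import Data.List.Membership.Propositional using () renaming (_∈_ to _∈ₗ_)
  open import Data.List.Membership.Propositional.Properties using (∈-++⁺ˡ; ∈-++⁺ʳ; ∈-map⁺)
  open import Data.List.Relation.Unary.Any using (here)
  open import Data.List.Relation.Unary.All as All using ([]; _∷_)
  open import Data.List.Relation.Unary.All.Properties using (mapMaybe⁺; map⁺)
  open import Data.Maybe as Maybe using (Maybe; just; nothing)
  import Data.Maybe.Relation.Unary.All as MaybeAll
  import Data.Maybe.Relation.Unary.All.Properties as MaybeAllₚ
  open import Data.Product using (Σ; _,_; proj₁)
  open import Data.Empty using (⊥-elim)
  open import Relation.Nullary using (yes; no)

  private variable
    n : ℕ
    A : Subset n
    i : Fin n

  lookup-restrict-∈ : ∀ x → i ∈ A → lookup (restrict A x) i ≡ lookup x i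
  lookup-restrict-∈ {i = i} {A} x i∈A =
    trans (lookup-zipWith _∧_ i A x) (cong (_∧ lookup x i) ([]=⇒lookup i∈A))

  lookup-restrict-∉ : ∀ x → i ∉ A → lookup (restrict A x) i ≡ false
  lookup-restrict-∉ {i = i} {A} x i∉A with lookup A i in eq
  ... | true  = ⊥-elim (i∉A (lookup⇒[]= i A eq))
  ... | false = trans (lookup-zipWith _∧_ i A x) (cong (_∧ lookup x i) eq)

  evalLit-restrict-∈ : ∀ b x → i ∈ A → evalLit (i , b) (restrict A x) ≡ evalLit (i , b) x
  evalLit-restrict-∈ true  x i∈A = lookup-restrict-∈ x i∈A
  evalLit-restrict-∈ false x i∈A = cong not (lookup-restrict-∈ x i∈A)

  evalLit-restrict-∉ : ∀ b x → i ∉ A → evalLit (i , b) (restrict A x) ≡ not b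
  evalLit-restrict-∉ true  x i∉A = lookup-restrict-∉ x i∉A
  evalLit-restrict-∉ false x i∉A = cong not (lookup-restrict-∉ x i∉A)

  evalTerm-restrict : ∀ {t : Term n} → TermOver A t → ∀ x → evalTerm t (restrict A x) ≡ evalTerm t x
  evalTerm-restrict [] x = refl
  evalTerm-restrict {t = (i , b) ∷ t} (i∈A ∷ t⊆A) x =
    cong₂ _∧_ (evalLit-restrict-∈ b x i∈A) (evalTerm-restrict t⊆A x)

  restrict-∈-cube : ∀ (A : Subset n) x → restrict A x ∈ₗ cube A
  restrict-∈-cube []           []          = here refl
  restrict-∈-cube (inside ∷ A) (false ∷ x) = ∈-++⁺ˡ (∈-map⁺ (false ∷_) (restrict-∈-cube A x))
  restrict-∈-cube (inside ∷ A) (true ∷ x)  = ∈-++⁺ʳ _ (∈-map⁺ (true ∷_) (restrict-∈-cube A x))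
  restrict-∈-cube (outside ∷ A) (_ ∷ x)    = ∈-map⁺ (false ∷_) (restrict-∈-cube A x)

  -- Sets every variable outside S to 0; nothing stands for a term that this falsifies.
  restrictTerm : Subset n → Term n → Maybe (Term n)
  restrictTerm S []            = just []
  restrictTerm S ((i , b) ∷ t) with i ∈? S
  ... | yes _ = Maybe.map ((i , b) ∷_) (restrictTerm S t)
  ... | no  _ = if b then nothing else restrictTerm S t

  evalMaybeTerm : Maybe (Term n) → BF n
  evalMaybeTerm (just t) x = evalTerm t x
  evalMaybeTerm nothing  x = false

  evalMaybeTerm-map-∷ : ∀ l (mt : Maybe (Term n)) x →
    evalMaybeTerm (Maybe.map (l ∷_) mt) x ≡ evalLit l x ∧ evalMaybeTerm mt x
  evalMaybeTerm-map-∷ l (just t) x = refl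
  evalMaybeTerm-map-∷ l nothing  x = sym (∧-zeroʳ (evalLit l x))

  restrictTerm-eval : ∀ S (t : Term n) x → evalMaybeTerm (restrictTerm S t) x ≡ evalTerm t (restrict S x)
  restrictTerm-eval S []            x = refl
  restrictTerm-eval S ((i , b) ∷ t) x with i ∈? S
  ... | yes i∈S = trans (evalMaybeTerm-map-∷ (i , b) (restrictTerm S t) x)
                        (cong₂ _∧_ (sym (evalLit-restrict-∈ b x i∈S)) (restrictTerm-eval S t x))
  ... | no  i∉S = trans (dropped b)
                        (cong (_∧ evalTerm t (restrict S x)) (sym (evalLit-restrict-∉ b x i∉S)))
    where
    dropped : ∀ b →
      evalMaybeTerm (if b then nothing else restrictTerm S t) x ≡ not b ∧ evalTerm t (restrict S x)
    dropped true  = refl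
    dropped false = restrictTerm-eval S t x

  restrictTerm-over : ∀ S (t : Term n) → MaybeAll.All (TermOver S) (restrictTerm S t)
  restrictTerm-over S []            = MaybeAll.just []
  restrictTerm-over S ((i , b) ∷ t) with i ∈? S
  ... | yes i∈S = MaybeAllₚ.map⁺ (MaybeAll.map (i∈S ∷_) (restrictTerm-over S t))
  ... | no  _   = dropped b
    where
    dropped : ∀ b → MaybeAll.All (TermOver S) (if b then nothing else restrictTerm S t)
    dropped true  = MaybeAll.nothing
    dropped false = restrictTerm-over S t

  restrictDNF : Subset n → DNF n → DNF n
  restrictDNF S = List.mapMaybe (restrictTerm S)

  restrictDNF-eval : ∀ S (d : DNF n) x → evalDNF (restrictDNF S d) x ≡ evalDNF d (restrict S x)
  restrictDNF-eval S []      x = refl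
  restrictDNF-eval S (t ∷ d) x with restrictTerm S t | restrictTerm-eval S t x
  ... | nothing | false≡t = trans (restrictDNF-eval S d x) (cong (_∨ evalDNF d (restrict S x)) false≡t)
  ... | just t' | t'≡t    = cong₂ _∨_ t'≡t (restrictDNF-eval S d x)

  restrictDNF-over : ∀ S (d : DNF n) → DNFOver S (restrictDNF S d)
  restrictDNF-over S d = mapMaybe⁺ (map⁺ (All.universal (restrictTerm-over S) d))

  -- restrict A x is the vector A ∩ x, so the lattice laws of Subset apply to it.
  junta-restrict-∩ : ∀ {μ} (R : Subset n) (f : BF n) (j : IsJunta R f μ) x →
    f (restrict (R ∩ proj₁ j) x) ≡ f (restrict R x)
  junta-restrict-∩ R f (S , _ , depends) x =
    depends (restrict (R ∩ S) x) (restrict R x) R∩S-x∈cube (restrict-∈-cube R x) same-on-S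
    where
    R∩S-x∈cube : restrict (R ∩ S) x ∈ₗ cube R
    R∩S-x∈cube = subst (_∈ₗ cube R) (sym (∩-assoc R S x)) (restrict-∈-cube R (restrict S x))
    same-on-S : restrict S (restrict (R ∩ S) x) ≡ restrict S (restrict R x)
    same-on-S = begin
      S ∩ ((R ∩ S) ∩ x)  ≡⟨ cong (λ T → S ∩ (T ∩ x)) (∩-comm R S) ⟩
      S ∩ ((S ∩ R) ∩ x)  ≡⟨ cong (S ∩_) (∩-assoc S R x) ⟩
      S ∩ (S ∩ (R ∩ x))  ≡⟨ ∩-assoc S S (R ∩ x) ⟨
      (S ∩ S) ∩ (R ∩ x)  ≡⟨ cong (_∩ (R ∩ x)) (∩-idem S) ⟩
      S ∩ (R ∩ x)        ∎
      where open ≡-Reasoning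

  conjunction⊗juntaDNF⇒factoredDNF : ∀ {r μ} (R : Subset n) (C : Term n) (D : DNF n) →
    IsConjunction (∁ R) C → IsJuntaDNF R r μ D →
    Σ (FactoredDNF n r μ) λ g → evalFactored g ≗ evalTerm C ⊗⟨ R ⟩ evalDNF D
  conjunction⊗juntaDNF⇒factoredDNF {n} {r} {μ} R C D C⊆∁R (_ , few-terms , junta@(S , S-small , _)) =
    g , g≗C⊗D
    where
    g : FactoredDNF n r μ
    g = record
      { H          = C
      ; Ts         = restrictDNF (R ∩ S) D
      ; few-terms  = ≤-trans (length-mapMaybe (restrictTerm (R ∩ S)) D) few-terms
      ; S          = R ∩ S
      ; S-small    = ≤-trans (∣p∩q∣≤∣q∣ R S) S-small
      ; Ts-in-S    = restrictDNF-over (R ∩ S) D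
      ; H-disjoint = All.map (λ i∈∁R i∈R∩S → x∈∁p⇒x∉p i∈∁R (proj₁ (x∈p∩q⁻ R S i∈R∩S))) C⊆∁R
      }
    g≗C⊗D : evalFactored g ≗ evalTerm C ⊗⟨ R ⟩ evalDNF D
    g≗C⊗D x = cong₂ _∧_ (sym (evalTerm-restrict C⊆∁R x))
                        (trans (restrictDNF-eval (R ∩ S) D x) (junta-restrict-∩ R (evalDNF D) junta x))

module Arithmetic where

  open import Data.Nat as ℕ using (ℕ; suc)
  open import Data.Nat.Properties using (m+[n∸m]≡n)
  open import Data.Integer as ℤ using (+_)
  import Data.Integer.Properties as ℤ
  open import Data.Rational
    using (ℚ; _/_; 0ℚ; 1ℚ; ½; _+_; _*_; _≤_; _<_; NonNegative; Positive; positive; toℚᵘ)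
  open import Data.Rational.Properties
  import Data.Rational.Unnormalised as ℚᵘ
  import Data.Rational.Unnormalised.Properties as ℚᵘ
  open import Data.Rational.Solver using (module +-*-Solver)
  open import Relation.Nullary.Decidable using (from-yes)

  toℚᵘ-ℕtoℚ : ∀ k → toℚᵘ (ℕtoℚ k) ℚᵘ.≃ + k ℚᵘ./ 1
  toℚᵘ-ℕtoℚ k = toℚᵘ-fromℚᵘ (+ k ℚᵘ./ 1)

  ℕtoℚ-homo-+ : ∀ m n → ℕtoℚ (m ℕ.+ n) ≡ ℕtoℚ m + ℕtoℚ n
  ℕtoℚ-homo-+ m n = toℚᵘ-injective (begin-equality
    toℚᵘ (ℕtoℚ (m ℕ.+ n))             ≃⟨ toℚᵘ-ℕtoℚ (m ℕ.+ n) ⟩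
    + (m ℕ.+ n) ℚᵘ./ 1                 ≃⟨ ℚᵘ.*≡* (cong (ℤ._* + 1) +[m+n]≡+m*1++n*1) ⟩
    + m ℚᵘ./ 1 ℚᵘ.+ + n ℚᵘ./ 1         ≃⟨ ℚᵘ.+-cong (toℚᵘ-ℕtoℚ m) (toℚᵘ-ℕtoℚ n) ⟨
    toℚᵘ (ℕtoℚ m) ℚᵘ.+ toℚᵘ (ℕtoℚ n)   ≃⟨ toℚᵘ-homo-+ (ℕtoℚ m) (ℕtoℚ n) ⟨
    toℚᵘ (ℕtoℚ m + ℕtoℚ n)             ∎)
    where
    open ℚᵘ.≤-Reasoning
    +[m+n]≡+m*1++n*1 : + (m ℕ.+ n) ≡ + m ℤ.* + 1 ℤ.+ + n ℤ.* + 1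
    +[m+n]≡+m*1++n*1 =
      trans (ℤ.pos-+ m n) (sym (cong₂ ℤ._+_ (ℤ.*-identityʳ (+ m)) (ℤ.*-identityʳ (+ n))))

  ℕtoℚ-homo-* : ∀ m n → ℕtoℚ (m ℕ.* n) ≡ ℕtoℚ m * ℕtoℚ n
  ℕtoℚ-homo-* m n = toℚᵘ-injective (begin-equality
    toℚᵘ (ℕtoℚ (m ℕ.* n))             ≃⟨ toℚᵘ-ℕtoℚ (m ℕ.* n) ⟩
    + (m ℕ.* n) ℚᵘ./ 1                 ≃⟨ ℚᵘ.*≡* (cong (ℤ._* + 1) (ℤ.pos-* m n)) ⟩
    (+ m ℚᵘ./ 1) ℚᵘ.* (+ n ℚᵘ./ 1)     ≃⟨ ℚᵘ.*-cong (toℚᵘ-ℕtoℚ m) (toℚᵘ-ℕtoℚ n) ⟨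
    toℚᵘ (ℕtoℚ m) ℚᵘ.* toℚᵘ (ℕtoℚ n)   ≃⟨ toℚᵘ-homo-* (ℕtoℚ m) (ℕtoℚ n) ⟨
    toℚᵘ (ℕtoℚ m * ℕtoℚ n)             ∎)
    where open ℚᵘ.≤-Reasoning

  ℕtoℚ-nonNeg : ∀ k → NonNegative (ℕtoℚ k)
  ℕtoℚ-nonNeg k = normalize-nonNeg k 1

  ℕtoℚ-mono-≤ : ∀ {m n} → m ℕ.≤ n → ℕtoℚ m ≤ ℕtoℚ n
  ℕtoℚ-mono-≤ {m} {n} m≤n = begin
    ℕtoℚ m                        ≡⟨ +-identityʳ (ℕtoℚ m) ⟨
    ℕtoℚ m + 0ℚ                   ≤⟨ +-monoʳ-≤ (ℕtoℚ m) (nonNegative⁻¹ _ {{ℕtoℚ-nonNeg (n ℕ.∸ m)}}) ⟩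
    ℕtoℚ m + ℕtoℚ (n ℕ.∸ m)       ≡⟨ ℕtoℚ-homo-+ m (n ℕ.∸ m) ⟨
    ℕtoℚ (m ℕ.+ (n ℕ.∸ m))        ≡⟨ cong ℕtoℚ (m+[n∸m]≡n m≤n) ⟩
    ℕtoℚ n                        ∎
    where open ≤-Reasoning

  ℕtoℚ-pos : ∀ {k} → 0 ℕ.< k → 0ℚ < ℕtoℚ k
  ℕtoℚ-pos {suc k} _ = positive⁻¹ (ℕtoℚ (suc k)) {{normalize-pos (suc k) 1}}

  p≤1⇒p*q≤q : ∀ {p} q .{{_ : NonNegative q}} → p ≤ 1ℚ → p * q ≤ q
  p≤1⇒p*q≤q q p≤1 = ≤-trans (*-monoʳ-≤-nonNeg q p≤1) (≤-reflexive (*-identityˡ q))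

  cross-terms-≤ : ∀ k A B P Q →
    .{{_ : NonNegative k}} .{{_ : NonNegative A}} .{{_ : NonNegative B}} .{{_ : NonNegative Q}} →
    k ≤ 1ℚ → P ≤ k * A → Q ≤ k * B → P * B + (A + P) * Q ≤ + 3 / 1 * (k * (A * B))
  cross-terms-≤ k A B P Q k≤1 P≤kA Q≤kB = begin
    P * B + (A + P) * Q              ≤⟨ +-monoʳ-≤ (P * B) (*-monoʳ-≤-nonNeg Q (+-monoʳ-≤ A P≤A)) ⟩
    P * B + (A + A) * Q              ≤⟨ +-mono-≤ (*-monoʳ-≤-nonNeg B P≤kA)
                                                 (*-monoˡ-≤-nonNeg (A + A) {{nonNeg+nonNeg⇒nonNeg A A}} Q≤kB) ⟩
    (k * A) * B + (A + A) * (k * B)  ≡⟨ solve 3 (λ k A B → (k :* A) :* B :+ (A :+ A) :* (k :* B)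
                                                          := con (+ 3 / 1) :* (k :* (A :* B))) refl k A B ⟩
    + 3 / 1 * (k * (A * B))          ∎
    where
    open ≤-Reasoning
    open +-*-Solver using (solve; _:=_; con; _:+_; _:*_)
    P≤A : P ≤ A
    P≤A = ≤-trans P≤kA (p≤1⇒p*q≤q A k≤1)

  distance-budget : ∀ e H A B P Q X Y Z →
    .{{_ : NonNegative A}} .{{_ : NonNegative B}} .{{_ : NonNegative Q}} →
    0ℚ < e → e ≤ ½ → 0ℚ < H →
    X ≤ (e * (+ 1 / 20)) * H → Y ≤ (e * (+ 1 / 20)) * H →
    P ≤ (e * (+ 1 / 10)) * A → Q ≤ (e * (+ 1 / 10)) * B →
    A * B ≤ H + Y → Z ≤ (X + Y) + (P * B + (A + P) * Q) → Z < e * H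
  distance-budget e H A B P Q X Y Z 0<e e≤½ 0<H X≤ Y≤ P≤ Q≤ AB≤H+Y Z≤ = begin-strict
    Z
      ≤⟨ Z≤ ⟩
    (X + Y) + (P * B + (A + P) * Q)
      ≤⟨ +-mono-≤ (+-mono-≤ X≤ Y≤) (cross-terms-≤ k A B P Q k≤1 P≤ Q≤) ⟩
    (e/20 * H + e/20 * H) + three * (k * (A * B))
      ≤⟨ +-monoʳ-≤ (e/20 * H + e/20 * H) (*-monoˡ-≤-nonNeg three (*-monoˡ-≤-nonNeg k AB≤2H)) ⟩
    (e/20 * H + e/20 * H) + three * (k * (H + H))
      ≡⟨ solve 2 (λ e H → (e :* con (+ 1 / 20) :* H :+ e :* con (+ 1 / 20) :* H)
                           :+ con three :* (e :* con (+ 1 / 10) :* (H :+ H))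
                           := con (+ 7 / 10) :* (e :* H)) refl e H ⟩
    + 7 / 10 * (e * H)
      <⟨ *-monoˡ-<-pos (e * H) (from-yes (+ 7 / 10 <? 1ℚ)) ⟩
    1ℚ * (e * H)
      ≡⟨ *-identityˡ (e * H) ⟩
    e * H ∎
    where
    open ≤-Reasoning
    open +-*-Solver using (solve; _:=_; con; _:+_; _:*_)
    k e/20 three : ℚ
    k = e * (+ 1 / 10)
    e/20 = e * (+ 1 / 20)
    three = + 3 / 1
    instance
      _ : Positive e
      _ = positive 0<e
      _ : Positive H
      _ = positive 0<H
      _ : NonNegative k
      _ = nonNeg*nonNeg⇒nonNeg e {{pos⇒nonNeg e}} (+ 1 / 10)
      _ : Positive (e * H)
      _ = pos*pos⇒pos e H
    e*-≤1 : ∀ c .{{_ : NonNegative c}} → ½ * c ≤ 1ℚ → e * c ≤ 1ℚ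
    e*-≤1 c ½c≤1 = ≤-trans (*-monoʳ-≤-nonNeg c e≤½) ½c≤1
    k≤1 : k ≤ 1ℚ
    k≤1 = e*-≤1 (+ 1 / 10) (from-yes (½ * (+ 1 / 10) ≤? 1ℚ))
    e/20≤1 : e/20 ≤ 1ℚ
    e/20≤1 = e*-≤1 (+ 1 / 20) (from-yes (½ * (+ 1 / 20) ≤? 1ℚ))
    AB≤2H : A * B ≤ H + H
    AB≤2H = ≤-trans AB≤H+Y (+-monoʳ-≤ H (≤-trans Y≤ (p≤1⇒p*q≤q H {{pos⇒nonNeg H}} e/20≤1)))

  distance-budget-ℕ : ∀ (e : ℚ) (h x y a b p q z : ℕ) → 0ℚ < e → e ≤ ½ → 0 ℕ.< h →
    ℕtoℚ x ≤ (e * (+ 1 / 20)) * ℕtoℚ h → ℕtoℚ y ≤ (e * (+ 1 / 20)) * ℕtoℚ h →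
    ℕtoℚ p ≤ (e * (+ 1 / 10)) * ℕtoℚ a → ℕtoℚ q ≤ (e * (+ 1 / 10)) * ℕtoℚ b →
    a ℕ.* b ℕ.≤ h ℕ.+ y → z ℕ.≤ (x ℕ.+ y) ℕ.+ (p ℕ.* b ℕ.+ (a ℕ.+ p) ℕ.* q) →
    ℕtoℚ z < e * ℕtoℚ h
  distance-budget-ℕ e h x y a b p q z 0<e e≤½ 0<h x≤ y≤ p≤ q≤ ab≤h+y z≤ =
    distance-budget e ⟦ h ⟧ ⟦ a ⟧ ⟦ b ⟧ ⟦ p ⟧ ⟦ q ⟧ ⟦ x ⟧ ⟦ y ⟧ ⟦ z ⟧
      {{ℕtoℚ-nonNeg a}} {{ℕtoℚ-nonNeg b}} {{ℕtoℚ-nonNeg q}}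
      0<e e≤½ (ℕtoℚ-pos 0<h) x≤ y≤ p≤ q≤
      (subst₂ _≤_ (ℕtoℚ-homo-* a b) (ℕtoℚ-homo-+ h y) (ℕtoℚ-mono-≤ ab≤h+y))
      (subst (⟦ z ⟧ ≤_) expand (ℕtoℚ-mono-≤ z≤))
    where
    ⟦_⟧ : ℕ → ℚ
    ⟦_⟧ = ℕtoℚ
    expand : ⟦ (x ℕ.+ y) ℕ.+ (p ℕ.* b ℕ.+ (a ℕ.+ p) ℕ.* q) ⟧
           ≡ (⟦ x ⟧ + ⟦ y ⟧) + (⟦ p ⟧ * ⟦ b ⟧ + (⟦ a ⟧ + ⟦ p ⟧) * ⟦ q ⟧)
    expand = begin
      ⟦ (x ℕ.+ y) ℕ.+ (p ℕ.* b ℕ.+ (a ℕ.+ p) ℕ.* q) ⟧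
        ≡⟨ ℕtoℚ-homo-+ (x ℕ.+ y) (p ℕ.* b ℕ.+ (a ℕ.+ p) ℕ.* q) ⟩
      ⟦ x ℕ.+ y ⟧ + ⟦ p ℕ.* b ℕ.+ (a ℕ.+ p) ℕ.* q ⟧
        ≡⟨ cong₂ _+_ (ℕtoℚ-homo-+ x y) (ℕtoℚ-homo-+ (p ℕ.* b) ((a ℕ.+ p) ℕ.* q)) ⟩
      (⟦ x ⟧ + ⟦ y ⟧) + (⟦ p ℕ.* b ⟧ + ⟦ (a ℕ.+ p) ℕ.* q ⟧)
        ≡⟨ cong (λ s → (⟦ x ⟧ + ⟦ y ⟧) + s) (cong₂ _+_ (ℕtoℚ-homo-* p b) (ℕtoℚ-homo-* (a ℕ.+ p) q)) ⟩
      (⟦ x ⟧ + ⟦ y ⟧) + (⟦ p ⟧ * ⟦ b ⟧ + ⟦ a ℕ.+ p ⟧ * ⟦ q ⟧)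
        ≡⟨ cong (λ s → (⟦ x ⟧ + ⟦ y ⟧) + (⟦ p ⟧ * ⟦ b ⟧ + s * ⟦ q ⟧)) (ℕtoℚ-homo-+ a p) ⟩
      (⟦ x ⟧ + ⟦ y ⟧) + (⟦ p ⟧ * ⟦ b ⟧ + (⟦ a ⟧ + ⟦ p ⟧) * ⟦ q ⟧) ∎
      where open ≡-Reasoning

open Counting
open Restriction
open Arithmetic

open import Data.Nat as ℕ using (ℕ; _<_)
open import Data.Product using (Σ; _×_; _,_; proj₁; proj₂)
open import Data.Integer using (+_)
open import Data.Rational using (ℚ; _/_; 0ℚ; ½; _*_; _≤_)
open import Data.Rational as Q using ()
open import Data.Rational.Properties using (≰⇒>; <-asym)

lemma82 : (n : ℕ) (ε : ℚ) (r μ : ℕ) (h : BF n) (R : Subset n) (J : BF n) →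
    0ℚ Q.< ε → ε ≤ ½ → 0 < r → 0 < μ →
    0 < ones ⊤ h →
    Nonempty R →
    0 < ones R J →
    (∀ (g : FactoredDNF n r μ) → reldistGt ⊤ h (evalFactored g) ε) →
    Σ (DNF n) (λ D → IsJuntaDNF R r μ D × reldistLe R J (evalDNF D) (ε * (+ 1 / 10))) →
    ℕtoℚ (setminus ⊤ h (gammaSmall R h J)) ≤ (ε * (+ 1 / 20)) * ℕtoℚ (ones ⊤ h) →
    ℕtoℚ (setminus ⊤ (gammaSmall R h J) h) ≤ (ε * (+ 1 / 20)) * ℕtoℚ (ones ⊤ h) →
    ∀ (C : Term n) → IsConjunction (∁ R) C →
      reldistGt (∁ R) (Gamma R h J) (evalTerm C) (ε * (+ 1 / 10))
lemma82 n ε r μ h R J 0<ε ε≤½ _ _ 0<|h| _ _ h-far (D , D-junta , J≈D) h∖γ-small γ∖h-small C C⊆∁R =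
  ≰⇒> λ Γ≈C → <-asym (h-far g)
    (distance-budget-ℕ ε (ones ⊤ h) (setminus ⊤ h γ) (setminus ⊤ γ h) (ones (∁ R) Γ) (ones R J)
       (symdiff (∁ R) Γ (evalTerm C)) (symdiff R J (evalDNF D)) (symdiff ⊤ h (evalFactored g))
       0<ε ε≤½ 0<|h| h∖γ-small γ∖h-small Γ≈C J≈D |γ|≤|h|+|γ∖h|
       (symdiff-≤-via-⊗ R h (evalFactored g) Γ (evalTerm C) J (evalDNF D) g≗C⊗D))
  where
  Γ γ : BF n
  Γ = Gamma R h J
  γ = gammaSmall R h J
  factored : Σ (FactoredDNF n r μ) λ g → evalFactored g ≗ evalTerm C ⊗⟨ R ⟩ evalDNF D
  factored = conjunction⊗juntaDNF⇒factoredDNF R C D C⊆∁R D-junta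
  g : FactoredDNF n r μ
  g = proj₁ factored
  g≗C⊗D : evalFactored g ≗ evalTerm C ⊗⟨ R ⟩ evalDNF D
  g≗C⊗D = proj₂ factored
  |γ|≤|h|+|γ∖h| : ones (∁ R) Γ ℕ.* ones R J ℕ.≤ ones ⊤ h ℕ.+ setminus ⊤ γ h
  |γ|≤|h|+|γ∖h| =
    subst (ℕ._≤ ones ⊤ h ℕ.+ setminus ⊤ γ h) (ones-⊗ R Γ J) (ones≤ones+setminus ⊤ γ h)
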